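{- Let $S$ be a symmetric numerical semigroup with genus $g(S)$, Frobenius number $F(S)$, conductor $c(S)$ and multiplicity $m(S)$. Then $\sigma$ attains its maximum over $S\cap[0,c(S)]$ at some $s \in S$ with $g(S) - \left\lceil \frac{m(S)}{2}\right\rceil \leq s \leq g(S)$. Moreover, if $\sigma$ attains its maximum over $S\cap[0,c(S)]$ at some $s \in S \cap [0, c(S)-1]$, then $\sigma(s) = \sigma(F(S) - s + 1)$.
   Context: A numerical semigroup is a subset $S \subseteq \mathbb{N} = \{0,1,2,\ldots\}$ closed under addition, containing $0$, with finite complement. Its genus is $g(S) := |\mathbb{N}\setminus S|$, Frobenius number $F(S) := \max(\mathbb{N}\setminus S)$, conductor $c(S) := F(S)+1$, multiplicity $m(S) := \min(S\setminus\{0\})$. $S$ is symmetric if $c(S) = 2g(S)$ (equivalently, for every $x \in [0,F(S)]$, $x \in S$ iff $F(S)-x \notin S$). For $s \in S \cap [0,c(S)]$ define $\sigma(s) := \frac{s}{2} - |S \cap [0,s]| + 1$. -}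

module Defs where

open import Level using (0ℓ)
open import Data.Nat using (ℕ; zero; suc; _+_; _*_; _∸_; _≤_; _<_; ⌈_/2⌉)
open import Data.Integer using (+_)
open import Data.Rational using (ℚ; _/_; _-_; 1ℚ) renaming (_+_ to _+ℚ_; _≤_ to _≤ℚ_)
open import Data.List using (List; length; filter; upTo)
open import Data.Product using (Σ; _×_)
open import Relation.Binary.PropositionalEquality using (_≡_)
open import Relation.Unary using (Pred; Decidable; ∁)
open import Relation.Unary.Properties using (∁?)

record NumericalSemigroup : Set₁ where
  field
    _∈S    : Pred ℕ 0ℓ
    _∈S?   : Decidable _∈S
    zero∈S : 0 ∈S
    closed : ∀ {a b} → a ∈S → b ∈S → (a + b) ∈S
    bound  : ℕ
    cofinite : ∀ n → bound ≤ n → n ∈S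

open NumericalSemigroup public

countUpTo : NumericalSemigroup → ℕ → ℕ
countUpTo S s = length (filter (_∈S? S) (upTo (suc s)))

-- genus g(S) = |ℕ \ S|; all gaps lie below `bound`, so we count gaps in [0, bound)
genus : NumericalSemigroup → ℕ
genus S = length (filter (∁? (_∈S? S)) (upTo (bound S)))

-- c is the conductor: least c with all n ≥ c in S  (c = F(S) + 1)
IsConductor : NumericalSemigroup → ℕ → Set
IsConductor S c =
  (∀ n → c ≤ n → _∈S S n) × (∀ d → (∀ n → d ≤ n → _∈S S n) → c ≤ d)

IsMultiplicity : NumericalSemigroup → ℕ → Set
IsMultiplicity S m =
  _∈S S m × 0 < m × (∀ x → _∈S S x → 0 < x → m ≤ x)

IsSymmetric : NumericalSemigroup → ℕ → Set
IsSymmetric S c = c ≡ 2 * genus S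

σ : NumericalSemigroup → ℕ → ℚ
σ S s = ((+ s) / 2 - ((+ countUpTo S s) / 1)) +ℚ 1ℚ

IsMaxσ : NumericalSemigroup → ℕ → ℕ → Set
IsMaxσ S c s =
  _∈S S s × s ≤ c × (∀ t → _∈S S t → t ≤ c → σ S t ≤ℚ σ S s)

-- Write N(s) = |S ∩ [0, s]|, so that 2σ(s) = s - 2N(s) + 2.  Symmetry says that of x and
-- c - 1 - x exactly one lies in S; counting then gives g + N(s) = N(c - s) + s whenever s and
-- c - s lie in S, i.e. σ(s) = σ(c - s).  A maximiser s > 0 has s - 1 ∉ S (otherwise
-- σ(s - 1) > σ(s)), hence c - s ∈ S: this is the second claim, and it lets every maximiser be
-- reflected into [0, g].  For a nonzero a ∈ S, translation by a maps S into S, so the window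
-- (s, s + a] holds no more elements of S than its mirror image, with which it is complementary;
-- when s + ⌈a/2⌉ < g this gives σ(s + a) ≥ σ(s).  So the largest maximiser in [0, g] lies in
-- [g - ⌈a/2⌉, g].

module Submission where

open import Defs
open import Level using (0ℓ)
open import Data.Nat using (ℕ; zero; suc; _+_; _*_; _∸_; _≤_; _<_; _≤?_; z≤n; s≤s; s≤s⁻¹; ⌈_/2⌉)
open import Data.Nat.Properties
open import Data.Nat.Tactic.RingSolver using (solve-∀)
open import Data.Integer as ℤ using (ℤ)
import Data.Integer.Properties as ℤP
import Data.Integer.Tactic.RingSolver as ℤSolver
open import Data.Rational using (ℚ; _/_; _-_; 1ℚ; toℚᵘ)
  renaming (_+_ to _+ℚ_; _≤_ to _≤ℚ_; -_ to -ℚ_)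
import Data.Rational.Properties as ℚP
open import Data.Rational.Unnormalised as ℚᵘ using (mkℚᵘ; *≤*; *≡*)
import Data.Rational.Unnormalised.Properties as ℚᵘP
open import Data.List using ([]; _∷_; length; filter; upTo; _++_)
import Data.List.Properties as List
open import Data.Product using (Σ; _×_; _,_; proj₁; proj₂)
open import Data.Sum using (_⊎_; inj₁; inj₂; [_,_]′)
open import Relation.Nullary using (¬_; yes; no; contradiction)
open import Relation.Unary using (Pred; Decidable)
open import Relation.Unary.Properties using (∁?)
open import Relation.Binary.PropositionalEquality

-- Finite sums

∑ : (ℕ → ℕ) → ℕ → ℕ
∑ f zero    = 0
∑ f (suc k) = ∑ f k + f k

∑-cong : ∀ {f g} k → (∀ i → i < k → f i ≡ g i) → ∑ f k ≡ ∑ g k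
∑-cong zero    f≗g = refl
∑-cong (suc k) f≗g = cong₂ _+_ (∑-cong k (λ i i<k → f≗g i (m<n⇒m<1+n i<k))) (f≗g k ≤-refl)

∑-distrib-+ : ∀ f g k → ∑ (λ i → f i + g i) k ≡ ∑ f k + ∑ g k
∑-distrib-+ f g zero    = refl
∑-distrib-+ f g (suc k) = begin
  ∑ (λ i → f i + g i) k + (f k + g k) ≡⟨ cong (_+ (f k + g k)) (∑-distrib-+ f g k) ⟩
  ∑ f k + ∑ g k + (f k + g k)         ≡⟨ interchange (∑ f k) (∑ g k) (f k) (g k) ⟩
  ∑ f k + f k + (∑ g k + g k)         ∎
  where
  open ≡-Reasoning
  interchange : ∀ a b x y → a + b + (x + y) ≡ a + x + (b + y)
  interchange = solve-∀

∑-const : ∀ x k → ∑ (λ _ → x) k ≡ k * x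
∑-const x zero    = refl
∑-const x (suc k) = trans (cong (_+ x) (∑-const x k)) (+-comm (k * x) x)

∑-split : ∀ f j k → ∑ f (j + k) ≡ ∑ f j + ∑ (λ i → f (j + i)) k
∑-split f j zero    = trans (cong (∑ f) (+-identityʳ j)) (sym (+-identityʳ (∑ f j)))
∑-split f j (suc k) rewrite +-suc j k | ∑-split f j k = +-assoc (∑ f j) _ _

∑-reverse-complement : ∀ f g k → (∀ i j → i + j + 1 ≡ k → f i + g j ≡ 1) →
                       ∑ f k + ∑ g k ≡ k
∑-reverse-complement f g zero    _     = refl
∑-reverse-complement f g (suc k) compl = begin
  ∑ f k + f k + ∑ g (suc k)                     ≡⟨ cong (∑ f k + f k +_) (∑-split g 1 k) ⟩
  ∑ f k + f k + (g 0 + ∑ (λ i → g (suc i)) k)   ≡⟨ regroup (∑ f k) (f k) (g 0) _ ⟩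
  (f k + g 0) + (∑ f k + ∑ (λ i → g (suc i)) k)
    ≡⟨ cong₂ _+_ (compl k 0 (k+0+1≡1+k k))
                 (∑-reverse-complement f (λ i → g (suc i)) k shifted) ⟩
  suc k                                         ∎
  where
  open ≡-Reasoning
  regroup : ∀ a x y b → a + x + (y + b) ≡ (x + y) + (a + b)
  regroup = solve-∀
  k+0+1≡1+k : ∀ k → k + 0 + 1 ≡ suc k
  k+0+1≡1+k = solve-∀
  shifted : ∀ i j → i + j + 1 ≡ k → f i + g (suc j) ≡ 1
  shifted i j i+j+1≡k = compl i (suc j) (trans (cong (_+ 1) (+-suc i j)) (cong suc i+j+1≡k))

∑-≤ : ∀ f k → (∀ i → i < k → f i ≤ 1) → ∑ f k ≤ k
∑-≤ f zero    _   = z≤n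
∑-≤ f (suc k) f≤1 = subst (∑ f k + f k ≤_) (+-comm k 1)
  (+-mono-≤ (∑-≤ f k (λ i i<k → f≤1 i (m<n⇒m<1+n i<k))) (f≤1 k ≤-refl))

∑≡k⇒≡1 : ∀ f k → (∀ i → i < k → f i ≤ 1) → ∑ f k ≡ k → ∀ i → i < k → f i ≡ 1
∑≡k⇒≡1 f (suc k) f≤1 ∑≡1+k i i<1+k =
  [ ∑≡k⇒≡1 f k f≤1′ ∑k≡k i , (λ { refl → fk≡1 }) ]′ (m≤n⇒m<n∨m≡n (s≤s⁻¹ i<1+k))
  where
  f≤1′ : ∀ i → i < k → f i ≤ 1
  f≤1′ i i<k = f≤1 i (m<n⇒m<1+n i<k)
  ∑k≡k : ∑ f k ≡ k
  ∑k≡k = ≤-antisym (∑-≤ f k f≤1′) (+-cancelʳ-≤ 1 k (∑ f k) (begin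
    k + 1         ≡⟨ trans (+-comm k 1) (sym ∑≡1+k) ⟩
    ∑ f k + f k   ≤⟨ +-monoʳ-≤ (∑ f k) (f≤1 k ≤-refl) ⟩
    ∑ f k + 1     ∎))
    where open ≤-Reasoning
  fk≡1 : f k ≡ 1
  fk≡1 = +-cancelˡ-≡ (∑ f k) _ _ (trans ∑≡1+k (trans (+-comm 1 k) (cong (_+ 1) (sym ∑k≡k))))

𝟙 : {P : Pred ℕ 0ℓ} → Decidable P → ℕ → ℕ
𝟙 P? x with P? x
... | yes _ = 1
... | no  _ = 0

𝟙+𝟙∁≡1 : {P : Pred ℕ 0ℓ} (P? : Decidable P) → ∀ x → 𝟙 P? x + 𝟙 (∁? P?) x ≡ 1
𝟙+𝟙∁≡1 P? x with P? x
... | yes _ = refl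
... | no  _ = refl

module _ {P : Pred ℕ 0ℓ} (P? : Decidable P) where

  𝟙-∈ : ∀ {x} → P x → 𝟙 P? x ≡ 1
  𝟙-∈ {x} px with P? x
  ... | yes _   = refl
  ... | no  ¬px = contradiction px ¬px

  𝟙-∉ : ∀ {x} → ¬ P x → 𝟙 P? x ≡ 0
  𝟙-∉ {x} ¬px with P? x
  ... | yes px = contradiction px ¬px
  ... | no  _  = refl

  𝟙≡1⇒∈ : ∀ {x} → 𝟙 P? x ≡ 1 → P x
  𝟙≡1⇒∈ {x} _ with P? x
  𝟙≡1⇒∈ {x} _  | yes px = px
  𝟙≡1⇒∈ {x} () | no  _

  length-filter-upTo : ∀ k → length (filter P? (upTo k)) ≡ ∑ (𝟙 P?) k
  length-filter-upTo zero    = refl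
  length-filter-upTo (suc k) = begin
    length (filter P? (upTo (suc k)))
      ≡⟨ cong (λ xs → length (filter P? xs)) (sym (List.upTo-∷ʳ k)) ⟩
    length (filter P? (upTo k ++ k ∷ []))
      ≡⟨ cong length (List.filter-++ P? (upTo k) (k ∷ [])) ⟩
    length (filter P? (upTo k) ++ filter P? (k ∷ []))
      ≡⟨ List.length-++ (filter P? (upTo k)) ⟩
    length (filter P? (upTo k)) + length (filter P? (k ∷ []))
      ≡⟨ cong₂ _+_ (length-filter-upTo k) length-filter-singleton ⟩
    ∑ (𝟙 P?) k + 𝟙 P? k
      ∎
    where
    open ≡-Reasoning
    length-filter-singleton : length (filter P? (k ∷ [])) ≡ 𝟙 P? k
    length-filter-singleton with P? k
    ... | yes _ = refl
    ... | no  _ = refl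

-- Comparing values of σ

private
  -- σ S x is σ-value x (countUpTo S x) by definition; abstracting the count keeps it from being normalised.
  σ-value : ℕ → ℕ → ℚ
  σ-value x n = (ℤ.+ x / 2 - ℤ.+ n / 1) +ℚ 1ℚ

  twiceσ : ℕ → ℕ → ℤ
  twiceσ x n = ℤ.+ x ℤ.+ ℤ.+ 2 ℤ.- (ℤ.+ n ℤ.+ ℤ.+ n)

  toℚᵘ-σ-value : ∀ x n → toℚᵘ (σ-value x n) ℚᵘ.≃ mkℚᵘ (twiceσ x n) 1
  toℚᵘ-σ-value x n = begin
    toℚᵘ ((ℤ.+ x / 2 - ℤ.+ n / 1) +ℚ 1ℚ)                ≈⟨ ℚP.toℚᵘ-homo-+ (ℤ.+ x / 2 - ℤ.+ n / 1) 1ℚ ⟩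
    toℚᵘ (ℤ.+ x / 2 - ℤ.+ n / 1) ℚᵘ.+ toℚᵘ 1ℚ           ≈⟨ ℚᵘP.+-cong (ℚP.toℚᵘ-homo-+ (ℤ.+ x / 2) (-ℚ (ℤ.+ n / 1))) ℚᵘP.≃-refl ⟩
    (toℚᵘ (ℤ.+ x / 2) ℚᵘ.+ toℚᵘ (-ℚ (ℤ.+ n / 1))) ℚᵘ.+ toℚᵘ 1ℚ
      ≈⟨ ℚᵘP.+-cong (ℚᵘP.+-cong (ℚP.toℚᵘ-fromℚᵘ (mkℚᵘ (ℤ.+ x) 1))
                                (ℚᵘP.≃-trans (ℚP.toℚᵘ-homo‿- (ℤ.+ n / 1))
                                             (ℚᵘP.-‿cong (ℚP.toℚᵘ-fromℚᵘ (mkℚᵘ (ℤ.+ n) 0)))))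
                    ℚᵘP.≃-refl ⟩
    (mkℚᵘ (ℤ.+ x) 1 ℚᵘ.+ ℚᵘ.- mkℚᵘ (ℤ.+ n) 0) ℚᵘ.+ mkℚᵘ (ℤ.+ 1) 0
      ≈⟨ *≡* (cross-multiply (ℤ.+ x) (ℤ.+ n)) ⟩
    mkℚᵘ (twiceσ x n) 1                                  ∎
    where
    open ℚᵘP.≃-Reasoning
    cross-multiply : ∀ p q → ((p ℤ.* ℤ.+ 1 ℤ.+ (ℤ.- q) ℤ.* ℤ.+ 2) ℤ.* ℤ.+ 1 ℤ.+ ℤ.+ 1 ℤ.* ℤ.+ 2) ℤ.* ℤ.+ 2
                            ≡ (p ℤ.+ ℤ.+ 2 ℤ.- (q ℤ.+ q)) ℤ.* ℤ.+ 2
    cross-multiply = ℤSolver.solve-∀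

  +-cancelʳ-≤ᶻ : ∀ i j k → i ℤ.+ k ℤ.≤ j ℤ.+ k → i ℤ.≤ j
  +-cancelʳ-≤ᶻ i j k i+k≤j+k = subst₂ ℤ._≤_ (undo i) (undo j) (ℤP.+-monoˡ-≤ (ℤ.- k) i+k≤j+k)
    where
    undo : ∀ i → i ℤ.+ k ℤ.- k ≡ i
    undo i = trans (ℤP.+-assoc i k (ℤ.- k)) (trans (cong (λ z → i ℤ.+ z) (ℤP.+-inverseʳ k)) (ℤP.+-identityʳ i))

  -- Adding 2 na + 2 nb to both sides clears the subtractions.
  twiceσ+ˡ : ∀ p q r → (p ℤ.+ ℤ.+ 2 ℤ.- (q ℤ.+ q)) ℤ.+ ((q ℤ.+ q) ℤ.+ (r ℤ.+ r)) ≡ (p ℤ.+ (r ℤ.+ r)) ℤ.+ ℤ.+ 2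
  twiceσ+ˡ = ℤSolver.solve-∀

  twiceσ+ʳ : ∀ p q r → (p ℤ.+ ℤ.+ 2 ℤ.- (r ℤ.+ r)) ℤ.+ ((q ℤ.+ q) ℤ.+ (r ℤ.+ r)) ≡ (p ℤ.+ (q ℤ.+ q)) ℤ.+ ℤ.+ 2
  twiceσ+ʳ = ℤSolver.solve-∀

  twiceσ-≤⇒ : ∀ a na b nb → twiceσ a na ℤ.≤ twiceσ b nb → a + (nb + nb) ≤ b + (na + na)
  twiceσ-≤⇒ a na b nb ≤ᶻ = +-cancelʳ-≤ 2 _ _ (ℤP.drop‿+≤+
    (subst₂ ℤ._≤_ (twiceσ+ˡ (ℤ.+ a) (ℤ.+ na) (ℤ.+ nb)) (twiceσ+ʳ (ℤ.+ b) (ℤ.+ na) (ℤ.+ nb))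
            (ℤP.+-monoˡ-≤ (ℤ.+ (na + na + (nb + nb))) ≤ᶻ)))

  ≤⇒twiceσ-≤ : ∀ a na b nb → a + (nb + nb) ≤ b + (na + na) → twiceσ a na ℤ.≤ twiceσ b nb
  ≤⇒twiceσ-≤ a na b nb ≤ℕ = +-cancelʳ-≤ᶻ _ _ (ℤ.+ (na + na + (nb + nb)))
    (subst₂ ℤ._≤_ (sym (twiceσ+ˡ (ℤ.+ a) (ℤ.+ na) (ℤ.+ nb))) (sym (twiceσ+ʳ (ℤ.+ b) (ℤ.+ na) (ℤ.+ nb)))
            (ℤ.+≤+ (+-monoˡ-≤ 2 ≤ℕ)))

  σ-value-≤⇒ : ∀ a na b nb → σ-value a na ≤ℚ σ-value b nb → a + (nb + nb) ≤ b + (na + na)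
  σ-value-≤⇒ a na b nb σa≤σb
    with ℚᵘP.≤-respˡ-≃ (toℚᵘ-σ-value a na) (ℚᵘP.≤-respʳ-≃ (toℚᵘ-σ-value b nb) (ℚP.toℚᵘ-mono-≤ σa≤σb))
  ... | *≤* 2σa≤2σb = twiceσ-≤⇒ a na b nb (ℤP.*-cancelʳ-≤-pos _ _ (ℤ.+ 2) 2σa≤2σb)

  ≤⇒σ-value-≤ : ∀ a na b nb → a + (nb + nb) ≤ b + (na + na) → σ-value a na ≤ℚ σ-value b nb
  ≤⇒σ-value-≤ a na b nb ≤ℕ = ℚP.toℚᵘ-cancel-≤
    (ℚᵘP.≤-respˡ-≃ (ℚᵘP.≃-sym (toℚᵘ-σ-value a na)) (ℚᵘP.≤-respʳ-≃ (ℚᵘP.≃-sym (toℚᵘ-σ-value b nb))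
      (*≤* (ℤP.*-monoʳ-≤-nonNeg (ℤ.+ 2) (≤⇒twiceσ-≤ a na b nb ≤ℕ)))))

module _ (S : NumericalSemigroup) where

  σ≤σ⇒ : ∀ t s → σ S t ≤ℚ σ S s → t + (countUpTo S s + countUpTo S s) ≤ s + (countUpTo S t + countUpTo S t)
  σ≤σ⇒ t s = σ-value-≤⇒ t (countUpTo S t) s (countUpTo S s)

  ≤⇒σ≤σ : ∀ t s → t + (countUpTo S s + countUpTo S s) ≤ s + (countUpTo S t + countUpTo S t) → σ S t ≤ℚ σ S s
  ≤⇒σ≤σ t s = ≤⇒σ-value-≤ t (countUpTo S t) s (countUpTo S s)

-- Maximisers over a decidable subset of [0, k]

IsMaxOn : Pred ℕ 0ℓ → (ℕ → ℚ) → ℕ → ℕ → Set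
IsMaxOn P v k s = P s × s ≤ k × (∀ t → P t → t ≤ k → v t ≤ℚ v s)

IsMaxOn-transfer : ∀ {P v k s a} → IsMaxOn P v k s → P a → a ≤ k → v s ≤ℚ v a → IsMaxOn P v k a
IsMaxOn-transfer (_ , _ , max) pa a≤k vs≤va = pa , a≤k , λ t pt t≤k → ℚP.≤-trans (max t pt t≤k) vs≤va

∀≤-suc : ∀ {P : Pred ℕ 0ℓ} {Q : ℕ → Set} k → (∀ t → P t → t ≤ k → Q t) → (P (suc k) → Q (suc k)) →
         ∀ t → P t → t ≤ suc k → Q t
∀≤-suc k below top t pt t≤1+k =
  [ (λ t<1+k → below t pt (m<1+n⇒m≤n t<1+k)) , (λ { refl → top pt }) ]′ (m≤n⇒m<n∨m≡n t≤1+k)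

largest-argmax : ∀ {P} → Decidable P → (v : ℕ → ℚ) → P 0 → ∀ k →
                 Σ ℕ λ s → IsMaxOn P v k s × (∀ t → P t → t ≤ k → v s ≤ℚ v t → t ≤ s)
largest-argmax P? v p0 zero = 0 , (p0 , z≤n , λ { t _ z≤n → ℚP.≤-refl }) , λ t _ t≤0 _ → t≤0
largest-argmax P? v p0 (suc k) with largest-argmax P? v p0 k | P? (suc k)
... | s , (ps , s≤k , max) , largest | no ¬p =
  s , (ps , m≤n⇒m≤1+n s≤k , ∀≤-suc k max (λ p → contradiction p ¬p)) ,
  ∀≤-suc k largest (λ p → contradiction p ¬p)
... | s , (ps , s≤k , max) , largest | yes p with v s ℚP.≤? v (suc k)
...   | yes vs≤v1+k =
  suc k , (p , ≤-refl , ∀≤-suc k (λ t pt t≤k → ℚP.≤-trans (max t pt t≤k) vs≤v1+k) (λ _ → ℚP.≤-refl)) ,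
  λ _ _ t≤1+k _ → t≤1+k
...   | no vs≰v1+k =
  s , (ps , m≤n⇒m≤1+n s≤k , ∀≤-suc k max (λ _ → ℚP.<⇒≤ (ℚP.≰⇒> vs≰v1+k))) ,
  ∀≤-suc k largest (λ _ vs≤v1+k → contradiction vs≤v1+k vs≰v1+k)

infix 4 _∈_ _∉_

_∈_ : ℕ → NumericalSemigroup → Set
x ∈ S = _∈S S x

_∉_ : ℕ → NumericalSemigroup → Set
x ∉ S = ¬ x ∈ S

module Counting (S : NumericalSemigroup) where

  ι : ℕ → ℕ
  ι = 𝟙 (S ∈S?)

  N : ℕ → ℕ
  N = countUpTo S

  N≡∑ι : ∀ t → N t ≡ ∑ ι (suc t)
  N≡∑ι t = length-filter-upTo (S ∈S?) (suc t)

  N-suc-∈ : ∀ {s} → suc s ∈ S → N (suc s) ≡ N s + 1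
  N-suc-∈ {s} 1+s∈S = trans (N≡∑ι (suc s)) (cong₂ _+_ (sym (N≡∑ι s)) (𝟙-∈ (S ∈S?) 1+s∈S))

  -- If s and s + 1 lie in S, then σ (s + 1) = σ s - 1/2.
  pred-of-max∉S : ∀ {c s} → IsMaxσ S c (suc s) → s ∉ S
  pred-of-max∉S {c} {s} (1+s∈S , 1+s≤c , max) s∈S = contradiction
    (σ≤σ⇒ S s (suc s) (max s s∈S (≤-trans (n≤1+n s) 1+s≤c)))
    (<⇒≱ (subst (suc s + (N s + N s) <_) (sym (cong (λ n → s + (n + n)) (N-suc-∈ 1+s∈S)))
                (≤-reflexive (shape s (N s)))))
    where
    shape : ∀ s n → suc (suc s + (n + n)) ≡ s + ((n + 1) + (n + 1))
    shape = solve-∀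

module Symmetric (S : NumericalSemigroup) {c : ℕ}
                 (conductor : IsConductor S c) (symmetric : IsSymmetric S c) where

  open Counting S

  g : ℕ
  g = genus S

  c≡g+g : c ≡ g + g
  c≡g+g = trans symmetric (cong (g +_) (+-identityʳ g))

  ≥c⇒∈S : ∀ {n} → c ≤ n → n ∈ S
  ≥c⇒∈S = proj₁ conductor _

  c-1∉S : ∀ {x} → x + 1 ≡ c → x ∉ S
  c-1∉S {x} x+1≡c x∈S = contradiction
    (proj₂ conductor x λ n x≤n → [ (λ x<n → ≥c⇒∈S (subst (_≤ n) (trans (+-comm 1 x) x+1≡c) x<n))
                                 , (λ { refl → x∈S }) ]′ (m≤n⇒m<n∨m≡n x≤n))
    (<⇒≱ (≤-reflexive (trans (+-comm 1 x) x+1≡c)))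

  γ : ℕ → ℕ
  γ = 𝟙 (∁? (S ∈S?))

  g≡∑γ : g ≡ ∑ γ c
  g≡∑γ = begin
    g                                            ≡⟨ length-filter-upTo (∁? (S ∈S?)) (bound S) ⟩
    ∑ γ (bound S)                                ≡⟨ cong (∑ γ) (m+[n∸m]≡n c≤bound) ⟨
    ∑ γ (c + (bound S ∸ c))                      ≡⟨ ∑-split γ c (bound S ∸ c) ⟩
    ∑ γ c + ∑ (λ i → γ (c + i)) (bound S ∸ c)    ≡⟨ cong (∑ γ c +_) (∑-cong (bound S ∸ c) no-gaps) ⟩
    ∑ γ c + ∑ (λ _ → 0) (bound S ∸ c)            ≡⟨ cong (∑ γ c +_) (trans (∑-const 0 (bound S ∸ c)) (*-zeroʳ (bound S ∸ c))) ⟩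
    ∑ γ c + 0                                    ≡⟨ +-identityʳ _ ⟩
    ∑ γ c                                        ∎
    where
    open ≡-Reasoning
    c≤bound : c ≤ bound S
    c≤bound = proj₂ conductor (bound S) (cofinite S)
    no-gaps : ∀ i → i < bound S ∸ c → γ (c + i) ≡ 0
    no-gaps i _ = 𝟙-∉ (∁? (S ∈S?)) (λ gap → gap (≥c⇒∈S (m≤m+n c i)))

  +g≡c⇒≡g : ∀ {x} → x + g ≡ c → x ≡ g
  +g≡c⇒≡g x+g≡c = +-cancelʳ-≡ g _ _ (trans x+g≡c c≡g+g)

  ∑ι≡g : ∑ ι c ≡ g
  ∑ι≡g = +g≡c⇒≡g (begin
    ∑ ι c + g                     ≡⟨ cong (∑ ι c +_) g≡∑γ ⟩
    ∑ ι c + ∑ γ c                 ≡⟨ ∑-distrib-+ ι γ c ⟨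
    ∑ (λ i → ι i + γ i) c         ≡⟨ ∑-cong c (λ i _ → 𝟙+𝟙∁≡1 (S ∈S?) i) ⟩
    ∑ (λ _ → 1) c                 ≡⟨ ∑-const 1 c ⟩
    c * 1                         ≡⟨ *-identityʳ c ⟩
    c                             ∎)
    where open ≡-Reasoning

  c∸1+i≡j : ∀ {i j} → i + j + 1 ≡ c → c ∸ suc i ≡ j
  c∸1+i≡j {i} {j} i+j+1≡c = begin
    c ∸ suc i             ≡⟨ cong (_∸ suc i) (trans (sym i+j+1≡c) (shape i j)) ⟩
    suc i + j ∸ suc i     ≡⟨ m+n∸m≡n (suc i) j ⟩
    j                     ∎
    where
    open ≡-Reasoning
    shape : ∀ i j → i + j + 1 ≡ suc i + j
    shape = solve-∀

  i+[c∸1+i]+1≡c : ∀ {i} → i < c → i + (c ∸ suc i) + 1 ≡ c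
  i+[c∸1+i]+1≡c {i} i<c = trans (+-comm (i + (c ∸ suc i)) 1) (m+[n∸m]≡n i<c)

  ∑ι-reflected≡g : ∑ (λ i → ι (c ∸ suc i)) c ≡ g
  ∑ι-reflected≡g = +g≡c⇒≡g (begin
    ∑ (λ i → ι (c ∸ suc i)) c + g      ≡⟨ cong (∑ (λ i → ι (c ∸ suc i)) c +_) g≡∑γ ⟩
    ∑ (λ i → ι (c ∸ suc i)) c + ∑ γ c  ≡⟨ ∑-reverse-complement _ γ c (λ i j i+j+1≡c →
                                            subst (λ z → ι z + γ j ≡ 1) (sym (c∸1+i≡j i+j+1≡c)) (𝟙+𝟙∁≡1 (S ∈S?) j)) ⟩
    c                                  ∎)
    where open ≡-Reasoning

  -- Of two numbers adding up to the Frobenius number c - 1, exactly one lies in S: at most one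
  -- by closure, and at least one since S ∩ [0, c) and its reflection both have g = c / 2 elements.
  exactly-one : ∀ x y → x + y + 1 ≡ c → ι x + ι y ≡ 1
  exactly-one x y x+y+1≡c = subst (λ z → ι x + ι z ≡ 1) (c∸1+i≡j x+y+1≡c)
    (∑≡k⇒≡1 (λ i → ι i + ι (c ∸ suc i)) c at-most-one total x x<c)
    where
    x<c : x < c
    x<c = subst (x <_) x+y+1≡c (subst (_≤ x + y + 1) (+-comm x 1) (+-monoˡ-≤ 1 (m≤m+n x y)))
    at-most-one : ∀ i → i < c → ι i + ι (c ∸ suc i) ≤ 1
    at-most-one i i<c with (S ∈S?) i | (S ∈S?) (c ∸ suc i)
    ... | yes i∈S | yes j∈S = contradiction (closed S i∈S j∈S) (c-1∉S (i+[c∸1+i]+1≡c i<c))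
    ... | yes _   | no  _   = ≤-refl
    ... | no  _   | yes _   = ≤-refl
    ... | no  _   | no  _   = z≤n
    total : ∑ (λ i → ι i + ι (c ∸ suc i)) c ≡ c
    total = trans (∑-distrib-+ ι (λ i → ι (c ∸ suc i)) c)
                  (trans (cong₂ _+_ ∑ι≡g ∑ι-reflected≡g) (sym c≡g+g))

  ∉⇒reflection∈ : ∀ {x y} → x + y + 1 ≡ c → y ∉ S → x ∈ S
  ∉⇒reflection∈ {x} {y} x+y+1≡c y∉S = 𝟙≡1⇒∈ (S ∈S?)
    (trans (sym (+-identityʳ (ι x))) (trans (cong (ι x +_) (sym (𝟙-∉ (S ∈S?) y∉S))) (exactly-one x y x+y+1≡c)))

  -- S ∩ [c - s, c) is the mirror image of the gaps in [0, s).
  reflected-count : ∀ {s} → s ∈ S → s < c → c ∸ s ∈ S → g + N s ≡ N (c ∸ s) + s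
  reflected-count {s} s∈S s<c r∈S = begin
    g + N s                                ≡⟨ cong₂ _+_ (sym ∑ι≡g) (trans (N≡∑ι s) (cong (∑ ι s +_) (𝟙-∈ (S ∈S?) s∈S))) ⟩
    ∑ ι c + (∑ ι s + 1)                    ≡⟨ cong (λ k → ∑ ι k + (∑ ι s + 1)) (sym r+s≡c) ⟩
    ∑ ι (r + s) + (∑ ι s + 1)              ≡⟨ cong (_+ (∑ ι s + 1)) (∑-split ι r s) ⟩
    (∑ ι r + X) + (∑ ι s + 1)              ≡⟨ regroup (∑ ι r) X (∑ ι s) ⟩
    (∑ ι r + 1) + (X + ∑ ι s)              ≡⟨ cong₂ (λ a b → (∑ ι r + a) + b) (sym (𝟙-∈ (S ∈S?) r∈S)) X+∑ι≡s ⟩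
    ∑ ι (suc r) + s                        ≡⟨ cong (_+ s) (N≡∑ι r) ⟨
    N r + s                                ∎
    where
    open ≡-Reasoning
    r : ℕ
    r = c ∸ s
    r+s≡c : r + s ≡ c
    r+s≡c = m∸n+n≡m (<⇒≤ s<c)
    X : ℕ
    X = ∑ (λ i → ι (r + i)) s
    regroup : ∀ a x b → (a + x) + (b + 1) ≡ (a + 1) + (x + b)
    regroup = solve-∀
    shape : ∀ r i j → r + i + j + 1 ≡ r + (i + j + 1)
    shape = solve-∀
    X+∑ι≡s : X + ∑ ι s ≡ s
    X+∑ι≡s = ∑-reverse-complement (λ i → ι (r + i)) ι s λ i j i+j+1≡s →
      exactly-one (r + i) j (trans (shape r i j) (trans (cong (r +_) i+j+1≡s) r+s≡c))

  σ-reflect : ∀ {s} → s ∈ S → s < c → c ∸ s ∈ S → σ S s ≡ σ S (c ∸ s)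
  σ-reflect {s} s∈S s<c r∈S =
    ℚP.≤-antisym (≤⇒σ≤σ S s r (≤-reflexive balance)) (≤⇒σ≤σ S r s (≤-reflexive (sym balance)))
    where
    r : ℕ
    r = c ∸ s
    balance : s + (N r + N r) ≡ r + (N s + N s)
    balance = +-cancelʳ-≡ s _ _ (begin
      s + (N r + N r) + s            ≡⟨ double (N r) s ⟩
      (N r + s) + (N r + s)          ≡⟨ cong₂ _+_ (sym (reflected-count s∈S s<c r∈S)) (sym (reflected-count s∈S s<c r∈S)) ⟩
      (g + N s) + (g + N s)          ≡⟨ interchange g (N s) ⟩
      (g + g) + (N s + N s)          ≡⟨ cong (_+ (N s + N s)) (trans (sym c≡g+g) (sym (m∸n+n≡m (<⇒≤ s<c)))) ⟩
      (r + s) + (N s + N s)          ≡⟨ rotate r s (N s + N s) ⟩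
      r + (N s + N s) + s            ∎)
      where
      open ≡-Reasoning
      double : ∀ n s → s + (n + n) + s ≡ (n + s) + (n + s)
      double = solve-∀
      interchange : ∀ g n → (g + n) + (g + n) ≡ (g + g) + (n + n)
      interchange = solve-∀
      rotate : ∀ r s x → (r + s) + x ≡ r + x + s
      rotate = solve-∀

  -- The predecessor of a maximiser is a gap, so its reflection c - s lies in S.
  reflection-of-max∈S : ∀ {s} → IsMaxσ S c s → s < c → c ∸ s ∈ S
  reflection-of-max∈S {zero}  _   _   = ≥c⇒∈S ≤-refl
  reflection-of-max∈S {suc s} max s<c = ∉⇒reflection∈ r+s+1≡c (pred-of-max∉S max)
    where
    r+s+1≡c : c ∸ suc s + s + 1 ≡ c
    r+s+1≡c = trans (trans (+-assoc (c ∸ suc s) s 1) (cong (c ∸ suc s +_) (+-comm s 1))) (m∸n+n≡m (<⇒≤ s<c))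

  max-reflect : ∀ {s} → IsMaxσ S c s → 0 < s → IsMaxσ S c (c ∸ s)
  max-reflect {s} max@(s∈S , s≤c , _) 0<s with m≤n⇒m<n∨m≡n s≤c
  ... | inj₁ s<c = IsMaxOn-transfer max (reflection-of-max∈S max s<c) (m∸n≤m c s)
                                    (ℚP.≤-reflexive (σ-reflect s∈S s<c (reflection-of-max∈S max s<c)))
  ... | inj₂ refl = subst (IsMaxσ S c) (sym (n∸n≡0 c))
                          (IsMaxOn-transfer max (zero∈S S) z≤n
                                            (ℚP.≤-reflexive (sym (σ-reflect (zero∈S S) 0<s s∈S))))

  max≤genus : ∀ {u} → IsMaxσ S c u → Σ ℕ λ v → IsMaxσ S c v × v ≤ g × (v ≡ u ⊎ v ≡ c ∸ u)
  max≤genus {u} max with u ≤? g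
  ... | yes u≤g = u , max , u≤g , inj₁ refl
  ... | no  u≰g = c ∸ u , max-reflect max (≤-trans (s≤s z≤n) g<u) ,
                  m≤n+o⇒m∸n≤o c u (subst (_≤ u + g) (sym c≡g+g) (+-monoˡ-≤ g (<⇒≤ g<u))) , inj₂ refl
    where
    g<u : g < u
    g<u = ≰⇒> u≰g

  g≤c : g ≤ c
  g≤c = subst (g ≤_) (sym c≡g+g) (m≤m+n g g)

  some-max≤genus : Σ ℕ λ v → IsMaxσ S c v × v ≤ g
  some-max≤genus =
    let u , u-max , _ = largest-argmax (S ∈S?) (σ S) (zero∈S S) c
        v , v-max , v≤g , _ = max≤genus u-max
    in v , v-max , v≤g

  largest-max≤genus : Σ ℕ λ s → IsMaxσ S c s × s ≤ g × (∀ t → t ∈ S → t ≤ g → σ S s ≤ℚ σ S t → t ≤ s)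
  largest-max≤genus =
    let v , (v∈S , _ , v-max) , v≤g = some-max≤genus
        s , (s∈S , s≤g , s-max≤g) , largest = largest-argmax (S ∈S?) (σ S) (zero∈S S) g
    in s , (s∈S , ≤-trans s≤g g≤c , λ t t∈S t≤c → ℚP.≤-trans (v-max t t∈S t≤c) (s-max≤g v v∈S v≤g)) ,
       s≤g , largest

  module _ {a : ℕ} (a∈S : a ∈ S) where

    window : ℕ → ℕ
    window b = ∑ (λ i → ι (suc b + i)) a

    window-step : ∀ b → window b ≤ window (suc b)
    window-step b = +-cancelʳ-≤ (ι (suc b)) _ _ (begin
      window b + ι (suc b)                        ≤⟨ +-monoʳ-≤ (window b) translate ⟩
      window b + ι (suc b + a)                    ≡⟨ ∑-split (λ i → ι (suc b + i)) 1 a ⟩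
      ι (suc b + 0) + ∑ (λ i → ι (suc b + suc i)) a
        ≡⟨ cong₂ _+_ (cong ι (+-identityʳ (suc b))) (∑-cong a (λ i _ → cong ι (+-suc (suc b) i))) ⟩
      ι (suc b) + window (suc b)                  ≡⟨ +-comm (ι (suc b)) _ ⟩
      window (suc b) + ι (suc b)                  ∎)
      where
      open ≤-Reasoning
      translate : ι (suc b) ≤ ι (suc b + a)
      translate with (S ∈S?) (suc b)
      ... | yes 1+b∈S = ≤-reflexive (sym (𝟙-∈ (S ∈S?) (closed S 1+b∈S a∈S)))
      ... | no  _     = z≤n

    window-mono : ∀ b d → window b ≤ window (d + b)
    window-mono b zero    = ≤-refl
    window-mono b (suc d) = ≤-trans (window-mono b d) (window-step (d + b))

    window-pair : ∀ b b′ → b + b′ + a + 2 ≡ c → window b + window b′ ≡ a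
    window-pair b b′ b+b′+a+2≡c = ∑-reverse-complement _ _ a λ i j i+j+1≡a →
      exactly-one (suc b + i) (suc b′ + j)
        (trans (shape b b′ i j) (trans (cong (λ k → b + b′ + k + 2) i+j+1≡a) b+b′+a+2≡c))
      where
      shape : ∀ b b′ i j → suc b + i + (suc b′ + j) + 1 ≡ b + b′ + (i + j + 1) + 2
      shape = solve-∀

    -- σ (s + a) - σ s = a/2 - window s, and the window at s is at most its mirror image,
    -- with which it is complementary.
    σ≤σ+ : ∀ s → s + s + a + 2 ≤ c → σ S s ≤ℚ σ S (s + a)
    σ≤σ+ s room = ≤⇒σ≤σ S s (s + a) (begin
      s + (N (s + a) + N (s + a))                     ≡⟨ cong (λ n → s + (n + n)) N[s+a]≡ ⟩
      s + ((N s + window s) + (N s + window s))       ≡⟨ regroup s (N s) (window s) ⟩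
      (s + (N s + N s)) + (window s + window s)       ≤⟨ +-monoʳ-≤ (s + (N s + N s)) window-small ⟩
      (s + (N s + N s)) + a                           ≡⟨ swap s (N s + N s) a ⟩
      (s + a) + (N s + N s)                           ∎)
      where
      open ≤-Reasoning
      N[s+a]≡ : N (s + a) ≡ N s + window s
      N[s+a]≡ = trans (N≡∑ι (s + a)) (trans (∑-split ι (suc s) a) (cong (_+ window s) (sym (N≡∑ι s))))
      window-small : window s + window s ≤ a
      window-small with m≤n⇒∃[o]m+o≡n room
      ... | d , s+s+a+2+d≡c = ≤-trans (+-monoʳ-≤ (window s) (window-mono s d))
                                      (≤-reflexive (window-pair s (d + s) (trans (shape s a d) s+s+a+2+d≡c)))
        where
        shape : ∀ s a d → s + (d + s) + a + 2 ≡ s + s + a + 2 + d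
        shape = solve-∀
      regroup : ∀ s n w → s + ((n + w) + (n + w)) ≡ (s + (n + n)) + (w + w)
      regroup = solve-∀
      swap : ∀ s x a → (s + x) + a ≡ (s + a) + x
      swap = solve-∀

    room-below-genus : ∀ {s} → ⌈ a /2⌉ + s < g → s + s + a + 2 ≤ c
    room-below-genus {s} h+s<g = begin
      s + s + a + 2              ≤⟨ +-monoˡ-≤ 2 (+-monoʳ-≤ (s + s) a≤h+h) ⟩
      s + s + (h + h) + 2        ≡⟨ shape s h ⟩
      suc (h + s) + suc (h + s)  ≤⟨ +-mono-≤ h+s<g h+s<g ⟩
      g + g                      ≡⟨ c≡g+g ⟨
      c                          ∎
      where
      open ≤-Reasoning
      h = ⌈ a /2⌉
      a≤h+h : a ≤ h + h
      a≤h+h = subst (_≤ h + h) (⌊n/2⌋+⌈n/2⌉≡n a) (+-monoˡ-≤ h (⌊n/2⌋≤⌈n/2⌉ a))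
      shape : ∀ s h → s + s + (h + h) + 2 ≡ suc (h + s) + suc (h + s)
      shape = solve-∀

    s<c∸[s+a] : ∀ {s} → s + s + a + 2 ≤ c → s < c ∸ (s + a)
    s<c∸[s+a] {s} room = m+n≤o⇒m≤o∸n (suc s) (≤-trans (n≤1+n _) (≤-trans (≤-reflexive (shape s a)) room))
      where
      shape : ∀ s a → suc (suc s + (s + a)) ≡ s + s + a + 2
      shape = solve-∀

    max-step : ∀ {s} → IsMaxσ S c s → s + s + a + 2 ≤ c → IsMaxσ S c (s + a)
    max-step {s} s-max@(s∈S , _) room =
      IsMaxOn-transfer s-max (closed S s∈S a∈S) s+a≤c (σ≤σ+ s room)
      where
      shape : ∀ s a → s + a + (s + 2) ≡ s + s + a + 2
      shape = solve-∀
      s+a≤c : s + a ≤ c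
      s+a≤c = ≤-trans (m≤m+n (s + a) (s + 2)) (≤-trans (≤-reflexive (shape s a)) room)

    -- The witness is s + a or its reflection c - (s + a).
    larger-max≤genus : 0 < a → ∀ {s} → IsMaxσ S c s → ⌈ a /2⌉ + s < g →
                       Σ ℕ λ w → IsMaxσ S c w × w ≤ g × s < w
    larger-max≤genus 0<a {s} s-max h+s<g = exceeds-s (max≤genus (max-step s-max room))
      where
      room : s + s + a + 2 ≤ c
      room = room-below-genus h+s<g
      exceeds-s : (Σ ℕ λ w → IsMaxσ S c w × w ≤ g × (w ≡ s + a ⊎ w ≡ c ∸ (s + a))) →
                  Σ ℕ λ w → IsMaxσ S c w × w ≤ g × s < w
      exceeds-s (w , w-max , w≤g , inj₁ refl) = w , w-max , w≤g , subst (s <_) (+-comm a s) (m<n+m s 0<a)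
      exceeds-s (w , w-max , w≤g , inj₂ refl) = w , w-max , w≤g , s<c∸[s+a] room

    max-near-genus : 0 < a → Σ ℕ λ s → IsMaxσ S c s × g ∸ ⌈ a /2⌉ ≤ s × s ≤ g
    max-near-genus 0<a =
      let s , s-max@(s∈S , s≤c , _) , s≤g , largest = largest-max≤genus
          not-small : ¬ (⌈ a /2⌉ + s < g)
          not-small h+s<g =
            let w , (w∈S , _ , w-max) , w≤g , s<w = larger-max≤genus 0<a s-max h+s<g
            in <⇒≱ s<w (largest w w∈S w≤g (w-max s s∈S s≤c))
      in s , s-max , m≤n+o⇒m∸n≤o g ⌈ a /2⌉ (≮⇒≥ not-small) , s≤g

theorem2p13 : (S : NumericalSemigroup) (c m : ℕ) →
    IsConductor S c → IsMultiplicity S m → IsSymmetric S c →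
    (Σ ℕ λ s → IsMaxσ S c s × (genus S ∸ ⌈ m /2⌉ ≤ s) × (s ≤ genus S))
    × (∀ s → IsMaxσ S c s → s < c → σ S s ≡ σ S (c ∸ s))
theorem2p13 S c m conductor (m∈S , 0<m , _) symmetric =
  max-near-genus m∈S 0<m ,
  λ s s-max s<c → σ-reflect (proj₁ s-max) s<c (reflection-of-max∈S s-max s<c)
  where open Symmetric S conductor symmetric
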